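{- Let $w,w'\in S_n$ and let $M,M'$ be two (possibly equal) max shuffles on $S_n$. If $w\sim w'$ then $M(w)\sim M'(w')$.
   Context: $[n]=\{1,\dots,n\}$, $[a,b]=\{a,\dots,b\}$; $S_n$ is the group of bijections $[n]\to[n]$. A homing shuffle is a map $F:S_n\to S_n$ such that for every $w\in S_n$, setting $k:=w(1)$: (a) $F(w)(k)=k$, and (b) $F(w)(i)=w(i)$ for all $i>k$. A max shuffle is a homing shuffle $M$ such that for every $w\in S_n$ with $w(1)\neq1$, $M(w)(1)=\max(w([2,k]))$ where $k=w(1)$. For $w,w'\in S_n$ write $w\sim w'$ if $w(1)=w'(1)$ and $w(i)=w'(i)$ for all $i>w(1)$. -}

module Defs where

open import Data.Nat using (ℕ; zero; suc; _<_; _≤?_; _⊔_)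
open import Data.Fin using (Fin; toℕ) renaming (zero to fzero)
open import Data.Fin.Permutation using (Permutation′; _⟨$⟩ʳ_)
open import Data.List using (List; foldr; map; filter; allFin)
open import Data.Product using (_×_)
open import Relation.Nullary.Decidable using (_×-dec_)
open import Relation.Binary.PropositionalEquality using (_≡_; _≢_)
open import Function using (_∘_)

-- Convention: [m] = {1,…,m} is represented by Fin m, the element i : Fin m
-- standing for toℕ i + 1.  S_m is the type of permutations of Fin m.
-- Position 1 needs m ≥ 1, so we work with S (suc n).
S : ℕ → Set
S = Permutation′

app : ∀ {m} → S m → Fin m → Fin m
app w i = w ⟨$⟩ʳ i

-- maxImg f k = max { toℕ (f i) | 1 ≤ toℕ i ≤ k }   (0 if the range is empty)
-- i.e. (shifted by one) max of f over the 1-based positions [2, k+1].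
maxImg : ∀ {m} → (Fin m → Fin m) → ℕ → ℕ
maxImg {m} f k =
  foldr _⊔_ 0 (map (toℕ ∘ f) (filter (λ i → (1 ≤? toℕ i) ×-dec (toℕ i ≤? k)) (allFin m)))

IsHoming : ∀ {n} → (S (suc n) → S (suc n)) → Set
IsHoming F = ∀ w →
  (app (F w) (app w fzero) ≡ app w fzero)
  × (∀ i → toℕ (app w fzero) < toℕ i → app (F w) i ≡ app w i)

IsMaxShuffle : ∀ {n} → (S (suc n) → S (suc n)) → Set
IsMaxShuffle M = IsHoming M ×
  (∀ w → app w fzero ≢ fzero →
     toℕ (app (M w) fzero) ≡ maxImg (app w) (toℕ (app w fzero)))

_∼_ : ∀ {n} → S (suc n) → S (suc n) → Set
w ∼ w' = (app w fzero ≡ app w' fzero)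
  × (∀ i → toℕ (app w fzero) < toℕ i → app w i ≡ app w' i)

module Submission where

-- Write k = w(1).  A homing shuffle puts k at position k and leaves w unchanged
-- after it, and w ∼ w' says w and w' agree after k, so M(w) and M'(w') agree on
-- all positions ≥ k.  Their first entries agree as well: for k = 1 both are 1,
-- otherwise both are the maximum of w([2,k]) = w'([2,k]), the set of values
-- not used at position 1 or after k.  Finally that maximum is at least k − 1,
-- since w([2,k]) has k − 1 distinct elements, so every position beyond M(w)(1)
-- is ≥ k.

open import Defs
open import Data.Nat using (ℕ; zero; suc; _≤_; _<_; _≤?_; _⊔_; z≤n; s≤s)
open import Data.Nat.Properties
  using (n≮0; ≤-trans; ≤-antisym; ⊔-lub; m≤m⊔n; m≤n⊔m; ≰⇒>; m≤n⇒m<n∨m≡n)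
open import Data.Fin using (Fin; toℕ; fromℕ<; inject≤; _≟_) renaming (zero to fzero; suc to fsuc)
open import Data.Fin.Properties
  using (toℕ<n; toℕ≤pred[n]; toℕ-injective; suc-injective; toℕ-inject≤; inject≤-injective;
         fromℕ<-injective; injective⇒≤)
open import Data.Fin.Permutation using (_⟨$⟩ˡ_; inverseˡ; inverseʳ)
open import Data.List using (List; []; _∷_; foldr; map; filter; allFin)
open import Data.List.Membership.Propositional using (_∈_)
open import Data.List.Membership.Propositional.Properties
  using (∈-map⁺; ∈-map⁻; ∈-filter⁺; ∈-filter⁻; ∈-allFin)
open import Data.List.Relation.Unary.Any using (here; there)
open import Data.Product using (_×_; _,_; proj₁; proj₂; ∃)
open import Data.Sum using (inj₁; inj₂)
open import Data.Empty using (⊥-elim)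
open import Relation.Nullary using (Dec; yes; no)
open import Relation.Nullary.Decidable using (_×-dec_)
open import Relation.Binary.PropositionalEquality
  using (_≡_; refl; sym; trans; cong; subst; module ≡-Reasoning)
open import Function using (_∘_)
open ≡-Reasoning

maximum : List ℕ → ℕ
maximum = foldr _⊔_ 0

≤-maximum : ∀ {x} xs → x ∈ xs → x ≤ maximum xs
≤-maximum (y ∷ ys) (here refl) = m≤m⊔n y (maximum ys)
≤-maximum (y ∷ ys) (there x∈ys) = ≤-trans (≤-maximum ys x∈ys) (m≤n⊔m y (maximum ys))

maximum-least : ∀ {b} xs → (∀ {x} → x ∈ xs → x ≤ b) → maximum xs ≤ b
maximum-least []       bound = z≤n
maximum-least (y ∷ ys) bound = ⊔-lub (bound (here refl)) (maximum-least ys (bound ∘ there))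

maximum-mono-⊆ : ∀ xs ys → (∀ {x} → x ∈ xs → x ∈ ys) → maximum xs ≤ maximum ys
maximum-mono-⊆ xs ys sub = maximum-least xs (≤-maximum ys ∘ sub)

permutation-injective : ∀ {m} (σ : S m) {i j} → app σ i ≡ app σ j → i ≡ j
permutation-injective σ {i} {j} eq =
  trans (sym (inverseˡ σ)) (trans (cong (σ ⟨$⟩ˡ_) eq) (inverseˡ σ))

InWindow : ∀ {m} → ℕ → Fin m → Set
InWindow k i = 1 ≤ toℕ i × toℕ i ≤ k

inWindow? : ∀ {m} k (i : Fin m) → Dec (InWindow k i)
inWindow? k i = (1 ≤? toℕ i) ×-dec (toℕ i ≤? k)

windowValues : ∀ {m} → (Fin m → Fin m) → ℕ → List ℕ
windowValues {m} f k =
  map (toℕ ∘ f) (filter (inWindow? k) (allFin m))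

∈-windowValues⁺ : ∀ {m} (f : Fin m → Fin m) k {i} → InWindow k i → toℕ (f i) ∈ windowValues f k
∈-windowValues⁺ f k {i} win =
  ∈-map⁺ (toℕ ∘ f) (∈-filter⁺ (inWindow? k) (∈-allFin i) win)

∈-windowValues⁻ : ∀ {m} (f : Fin m → Fin m) k {x} →
  x ∈ windowValues f k → ∃ λ i → InWindow k i × x ≡ toℕ (f i)
∈-windowValues⁻ {m} f k x∈ with ∈-map⁻ (toℕ ∘ f) x∈
... | i , i∈ , refl = i , proj₂ (∈-filter⁻ (inWindow? k) {xs = allFin m} i∈) , refl

≤-maxImg : ∀ {m} (f : Fin m → Fin m) k {i} → InWindow k i → toℕ (f i) ≤ maxImg f k
≤-maxImg f k win = ≤-maximum (windowValues f k) (∈-windowValues⁺ f k win)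

-- A value of σ in the window is, in τ, neither at position 0 nor beyond the
-- window, because σ and τ agree there and σ is injective.
windowValues-⊆ : ∀ {m} (σ τ : S (suc m)) k →
  app σ fzero ≡ app τ fzero → (∀ j → k < toℕ j → app σ j ≡ app τ j) →
  ∀ {x} → x ∈ windowValues (app σ) k → x ∈ windowValues (app τ) k
windowValues-⊆ σ τ k same₀ sameBeyond x∈ with ∈-windowValues⁻ (app σ) k x∈
... | i , (1≤i , i≤k) , refl =
  subst (_∈ windowValues (app τ) k) (cong toℕ τj≡σi) (∈-windowValues⁺ (app τ) k (1≤j , j≤k))
  where
  j = τ ⟨$⟩ˡ app σ i
  τj≡σi : app τ j ≡ app σ i
  τj≡σi = inverseʳ τ
  1≤j : 1 ≤ toℕ j
  1≤j with toℕ j in toℕj≡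
  ... | suc _ = s≤s z≤n
  ... | zero with permutation-injective σ
                   (trans same₀ (trans (cong (app τ) (toℕ-injective (sym toℕj≡))) τj≡σi))
  ...   | refl = ⊥-elim (n≮0 1≤i)
  j≤k : toℕ j ≤ k
  j≤k with toℕ j ≤? k
  ... | yes j≤k = j≤k
  ... | no j≰k = ⊥-elim (j≰k (subst (λ x → toℕ x ≤ k) (sym j≡i) i≤k))
    where
    j≡i : j ≡ i
    j≡i = permutation-injective σ (trans (sameBeyond j (≰⇒> j≰k)) τj≡σi)

maxImg-cong : ∀ {n} (w w' : S (suc n)) → w ∼ w' →
  maxImg (app w) (toℕ (app w fzero)) ≡ maxImg (app w') (toℕ (app w' fzero))
maxImg-cong w w' (same₀ , sameBeyond) = trans
  (≤-antisym
    (maximum-mono-⊆ _ _ (windowValues-⊆ w w' _ same₀ sameBeyond))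
    (maximum-mono-⊆ _ _ (windowValues-⊆ w' w _ (sym same₀) (λ j k<j → sym (sameBeyond j k<j)))))
  (cong (maxImg (app w') ∘ toℕ) same₀)

-- Pigeonhole: the k values of σ in the window are distinct and at most maxImg σ k.
window-size≤maxImg : ∀ {n} (σ : S (suc n)) k → k ≤ n → k ≤ suc (maxImg (app σ) k)
window-size≤maxImg {n} σ k k≤n = injective⇒≤ {f = bounded} bounded-injective
  where
  position : Fin k → Fin (suc n)
  position j = fsuc (inject≤ j k≤n)
  position-window : ∀ j → InWindow k (position j)
  position-window j rewrite toℕ-inject≤ j k≤n = s≤s z≤n , toℕ<n j
  bounded : Fin k → Fin (suc (maxImg (app σ) k))
  bounded j = fromℕ< (s≤s (≤-maxImg (app σ) k (position-window j)))
  bounded-injective : ∀ {i j} → bounded i ≡ bounded j → i ≡ j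
  bounded-injective {i} {j} =
    inject≤-injective k≤n k≤n i j ∘ suc-injective ∘ permutation-injective σ
      ∘ toℕ-injective ∘ fromℕ<-injective _ _ _ _

homing-agree-from-head : ∀ {n} (F F' : S (suc n) → S (suc n)) (w w' : S (suc n)) →
  IsHoming F → IsHoming F' → w ∼ w' →
  ∀ i → toℕ (app w fzero) ≤ toℕ i → app (F w) i ≡ app (F' w') i
homing-agree-from-head F F' w w' hom hom' (same₀ , sameBeyond) i k≤i
  with m≤n⇒m<n∨m≡n k≤i
... | inj₁ k<i = begin
  app (F w) i    ≡⟨ proj₂ (hom w) i k<i ⟩
  app w i        ≡⟨ sameBeyond i k<i ⟩
  app w' i       ≡⟨ sym (proj₂ (hom' w') i (subst (λ x → toℕ x < toℕ i) same₀ k<i)) ⟩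
  app (F' w') i  ∎
... | inj₂ k≡i with toℕ-injective k≡i
...   | refl = begin
  app (F w) (app w fzero)    ≡⟨ proj₁ (hom w) ⟩
  app w fzero                ≡⟨ same₀ ⟩
  app w' fzero               ≡⟨ sym (proj₁ (hom' w')) ⟩
  app (F' w') (app w' fzero) ≡⟨ cong (app (F' w')) (sym same₀) ⟩
  app (F' w') (app w fzero)  ∎

homing-fixes-0 : ∀ {n} (F : S (suc n) → S (suc n)) (w : S (suc n)) →
  IsHoming F → app w fzero ≡ fzero → app (F w) fzero ≡ fzero
homing-fixes-0 F w hom w₀≡0 = subst (λ x → app (F w) x ≡ x) w₀≡0 (proj₁ (hom w))

maxShuffle-head-cong : ∀ {n} (M M' : S (suc n) → S (suc n)) (w w' : S (suc n)) →
  IsMaxShuffle M → IsMaxShuffle M' → w ∼ w' → app (M w) fzero ≡ app (M' w') fzero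
maxShuffle-head-cong M M' w w' (hom , max) (hom' , max') w∼w'@(same₀ , _)
  with app w fzero ≟ fzero
... | yes w₀≡0 =
  trans (homing-fixes-0 M w hom w₀≡0) (sym (homing-fixes-0 M' w' hom' (trans (sym same₀) w₀≡0)))
... | no w₀≢0 = toℕ-injective (begin
  toℕ (app (M w) fzero)                        ≡⟨ max w w₀≢0 ⟩
  maxImg (app w) (toℕ (app w fzero))           ≡⟨ maxImg-cong w w' w∼w' ⟩
  maxImg (app w') (toℕ (app w' fzero))         ≡⟨ sym (max' w' (w₀≢0 ∘ trans same₀)) ⟩
  toℕ (app (M' w') fzero)                      ∎)

maxShuffle-head-bound : ∀ {n} (M : S (suc n) → S (suc n)) (w : S (suc n)) →
  IsMaxShuffle M → toℕ (app w fzero) ≤ suc (toℕ (app (M w) fzero))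
maxShuffle-head-bound M w (_ , max) with app w fzero ≟ fzero
... | yes w₀≡0 = subst (_≤ suc (toℕ (app (M w) fzero))) (cong toℕ (sym w₀≡0)) z≤n
... | no w₀≢0 = subst (λ x → toℕ (app w fzero) ≤ suc x) (sym (max w w₀≢0))
  (window-size≤maxImg w _ (toℕ≤pred[n] (app w fzero)))

lemma6 : (n : ℕ) (M M' : S (suc n) → S (suc n)) (w w' : S (suc n)) →
    IsMaxShuffle M → IsMaxShuffle M' → w ∼ w' → M w ∼ M' w'
lemma6 n M M' w w' isMax isMax' w∼w' =
  maxShuffle-head-cong M M' w w' isMax isMax' w∼w' ,
  λ i head<i → homing-agree-from-head M M' w w' (proj₁ isMax) (proj₁ isMax') w∼w' i
                 (≤-trans (maxShuffle-head-bound M w isMax) head<i)
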